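{- For all integers $n,m,\ell$ with $2\le m\le n$ and $0\le\ell\le n-m$, \[W(\ell,n,m)>(n-1)\,W(\ell,n-1,m).\]
   Context: A partition of $\{1,\dots,n\}$ into $m$ linearly ordered blocks is a set partition into $m$ nonempty blocks, each equipped with a linear order (a sequence). For a block $b$, its weight $w(b)$ is the number of elements of $b$ that are smaller (as integers) than the first element of $b$; the weight of the partition $\pi$ is $w(\pi)=\sum_{b\in\pi}w(b)$. The weighted Lah number $W(\ell,n,m)$ is the number of partitions of $\{1,\dots,n\}$ into exactly $m$ linearly ordered blocks with weight $\ell$ (it is $0$ if no such partition exists). -}

module Defs where

open import Data.Nat using (ℕ; zero; suc; _+_; _∸_; _<ᵇ_; _≡ᵇ_)
open import Data.Bool using (Bool; true; false; _∧_; not; if_then_else_)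
open import Data.List using (List; []; _∷_; map; concatMap; concat; length; filter; upTo; foldr; splitAt)
open import Data.Bool.ListAction using (all; any)
open import Data.Nat.ListAction using (sum)
open import Data.Product using (_,_)
open import Relation.Nullary.Decidable using (Dec; yes; no)
open import Data.Bool using (T)
open import Relation.Nullary.Decidable using (T?)

-- A partition of {1,…,n} into m linearly ordered blocks is represented
-- canonically as a list of m nonempty lists (the blocks, each list being the
-- linear order of the block), listed in increasing order of their minimum
-- elements, whose concatenation contains each of 1,…,n exactly once.

range : ℕ → List ℕ
range n = map suc (upTo n)

words : ℕ → List ℕ → List (List ℕ)
words zero    as = [] ∷ []
words (suc k) as = concatMap (λ a → map (a ∷_) (words k as)) as

compositions : ℕ → ℕ → List (List ℕ)
compositions zero    zero    = [] ∷ []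
compositions (suc t) zero    = []
compositions t       (suc m) =
  concatMap (λ p → map (suc p ∷_) (compositions (t ∸ suc p) m)) (upTo t)

splitBy : List ℕ → List ℕ → List (List ℕ)
splitBy []       w = []
splitBy (k ∷ ks) w with splitAt k w
... | (u , v) = u ∷ splitBy ks v

-- a finite superset of all candidate representations of partitions of
-- {1,…,n} into m linearly ordered blocks
candidates : ℕ → ℕ → List (List (List ℕ))
candidates n m = concatMap (λ w → map (λ c → splitBy c w) (compositions n m)) (words n (range n))

memb : ℕ → List ℕ → Bool
memb x xs = any (λ y → x ≡ᵇ y) xs

distinct : List ℕ → Bool
distinct []       = true
distinct (x ∷ xs) = not (memb x xs) ∧ distinct xs

nonempty : List ℕ → Bool
nonempty []      = false
nonempty (_ ∷ _) = true

minimum : List ℕ → ℕ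
minimum []       = 0
minimum (x ∷ xs) = foldr (λ a b → if a <ᵇ b then a else b) x xs

increasingMins : List (List ℕ) → Bool
increasingMins []            = true
increasingMins (b ∷ [])      = true
increasingMins (b ∷ c ∷ bs)  = (minimum b <ᵇ minimum c) ∧ increasingMins (c ∷ bs)

isLinPartition : ℕ → ℕ → List (List ℕ) → Bool
isLinPartition n m π =
  (length π ≡ᵇ m) ∧ all nonempty π ∧ increasingMins π
  ∧ (length (concat π) ≡ᵇ n) ∧ distinct (concat π)
  ∧ all (λ x → memb x (range n)) (concat π)
  ∧ all (λ x → memb x (concat π)) (range n)

blockWeight : List ℕ → ℕ
blockWeight []       = 0
blockWeight (f ∷ xs) = length (filter (λ x → T? (x <ᵇ f)) xs)

weight : List (List ℕ) → ℕ
weight π = sum (map blockWeight π)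

W : ℕ → ℕ → ℕ → ℕ
W ℓ n m = length (filter (λ π → T? (isLinPartition n m π ∧ (weight π ≡ᵇ ℓ))) (candidates n m))

module Submission where

-- Insert n into a partition of {1,…,n-1} into m linearly ordered blocks, directly after one of its
-- n-1 elements. The number of blocks is unchanged, and so is the weight, because n is larger than
-- the first element of its block; deleting n recovers the partition, so the (n-1)·W(ℓ,n-1,m)
-- partitions obtained are distinct. None of them has the singleton block (n), whereas π₀ ∪ {(n)}
-- does, for a partition π₀ of {1,…,n-1} into m-1 blocks of weight ℓ; such a π₀ exists since
-- ℓ ≤ (n-1) - (m-1).

open import Defs
open import Data.Bool using (true; false; _∧_; not; T)
open import Data.Bool.ListAction using (all)
open import Data.Bool.Properties using (T-∧)
open import Data.Empty using (⊥-elim)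
open import Data.List
  using (List; []; _∷_; [_]; _++_; take; drop; splitAt; map; concat; concatMap; length; filter; upTo;
         cartesianProductWith; cartesianProduct)
open import Data.List.Membership.Propositional using (_∈_; _∉_; find; lose)
open import Data.List.Membership.Propositional.Properties
  using (∈-map⁺; ∈-map⁻; ∈-concat⁺′; ∈-++⁺ˡ; ∈-++⁺ʳ; ∈-++⁻; ∈-insert; ∈-concatMap⁺; ∈-concatMap⁻;
         ∈-cartesianProductWith⁺; ∈-cartesianProductWith⁻; ∈-cartesianProduct⁺; ∈-cartesianProduct⁻;
         ∈-upTo⁺; ∈-upTo⁻; ∈-filter⁺; ∈-filter⁻)
open import Data.List.Properties
  using (length-++; length-map; length-take; length-drop; map-++; map-∘; map-id-local; concat-++; ++-assoc;
         ++-identityʳ; splitAt-defn; take++drop≡id; filter-++; filter-reject; filter-all; filter-notAll;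
         ∷-injective; ∷-injectiveˡ; ∷-injectiveʳ; ≡-dec)
open import Data.List.Relation.Binary.Disjoint.Propositional using (Disjoint)
open import Data.List.Relation.Binary.Permutation.Propositional using (_↭_; ↭-sym; ↭⇒↭ₛ)
open import Data.List.Relation.Binary.Permutation.Propositional.Properties using (shift; ∈-resp-↭; ↭-length)
import Data.List.Relation.Binary.Permutation.Setoid.Properties as PermutationSetoid
open import Data.List.Relation.Binary.Subset.Propositional using (_⊆_)
open import Data.List.Relation.Unary.All as All using (All; []; _∷_)
import Data.List.Relation.Unary.All.Properties as AllP
open import Data.List.Relation.Unary.All.Properties using (all⁺; all⁻; ¬Any⇒All¬; All¬⇒¬Any)
open import Data.List.Relation.Unary.Any as Any using (here; there)
open import Data.List.Relation.Unary.Any.Properties using (any⁺; any⁻)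
open import Data.List.Relation.Unary.AllPairs using ([]; _∷_)
open import Data.List.Relation.Unary.Unique.Propositional using (Unique)
open import Data.List.Relation.Unary.Unique.Propositional.Properties
  using (++⁺; map⁺; map⁻; upTo⁺; cartesianProductWith⁺; cartesianProduct⁺; filter⁺)
open import Data.Nat using (ℕ; zero; suc; _+_; _*_; _∸_; _⊓_; _≤_; _<_; _<ᵇ_; _≡ᵇ_; _≟_; z≤n; s≤s)
open import Data.Nat.ListAction using (sum)
open import Data.Nat.ListAction.Properties using (sum-++)
open import Data.Nat.Properties
  using (≡ᵇ⇒≡; ≡⇒≡ᵇ; <ᵇ⇒<; <⇒<ᵇ; suc-injective; ≤-refl; ≤-trans; <⇒≤; ≮⇒≥; <-asym; n<1+n; 1+n≰n;
         m≤n⇒m≤1+n; m≤n⇒m<n∨m≡n; m≤m+n; m+n∸m≡n; m+[n∸m]≡n; +-comm; +-identityʳ; *-comm;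
         m≤n⇒m⊓n≡m; m≥n⇒m⊓n≡n; m⊓n≤n; module ≤-Reasoning)
open import Data.Product as Product using (_×_; _,_; proj₁; proj₂; ∃; uncurry)
open import Data.Sum using (inj₁; inj₂)
open import Data.Unit using (tt)
open import Function using (_∘_; const)
open import Function.Bundles using (_⇔_; mk⇔; Equivalence)
open import Relation.Binary.Definitions using (DecidableEquality)
open import Relation.Binary.PropositionalEquality
  using (_≡_; _≢_; refl; sym; trans; cong; cong₂; subst; subst₂; setoid; module ≡-Reasoning)
open import Relation.Nullary using (¬_; ¬?)
open import Relation.Nullary.Decidable using (T?)

open Equivalence using (to; from)

private variable
  A B C : Set
  n m : ℕ

Unique-⊆⇒length≤ : DecidableEquality A → {xs ys : List A} → Unique xs → xs ⊆ ys → length xs ≤ length ys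
Unique-⊆⇒length≤ _≟_ {[]} _ _ = z≤n
Unique-⊆⇒length≤ _≟_ {x ∷ xs} {ys} (x≢xs ∷ xs!) x∷xs⊆ys =
  ≤-trans (s≤s (Unique-⊆⇒length≤ _≟_ xs! xs⊆others)) others<ys
  where
  others = filter (¬? ∘ (_≟ x)) ys

  xs⊆others : xs ⊆ others
  xs⊆others z∈xs =
    ∈-filter⁺ (¬? ∘ (_≟ x)) (x∷xs⊆ys (there z∈xs)) (λ z≡x → All.lookup x≢xs z∈xs (sym z≡x))

  others<ys : length others < length ys
  others<ys =
    filter-notAll (¬? ∘ (_≟ x)) ys (Any.map (λ { refl x≢x → x≢x refl }) (x∷xs⊆ys (here refl)))

concatMap-Unique : {f : A → List B} {xs : List A} → Unique xs → (∀ {a} → a ∈ xs → Unique (f a)) →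
                   (∀ {a b} → a ∈ xs → b ∈ xs → a ≢ b → Disjoint (f a) (f b)) → Unique (concatMap f xs)
concatMap-Unique {xs = []} _ _ _ = []
concatMap-Unique {f = f} {xs = x ∷ xs} (x≢xs ∷ xs!) f! disjoint =
  ++⁺ (f! (here refl))
      (concatMap-Unique xs! (f! ∘ there) (λ a∈ b∈ → disjoint (there a∈) (there b∈)))
      fx#rest
  where
  fx#rest : Disjoint (f x) (concatMap f xs)
  fx#rest (z∈fx , z∈rest) with b , b∈xs , z∈fb ← find (∈-concatMap⁻ f z∈rest) =
    disjoint (here refl) (there b∈xs) (All.lookup x≢xs b∈xs) (z∈fx , z∈fb)

length-concatMap : {f : A → List B} (xs : List A) {k : ℕ} → (∀ {a} → a ∈ xs → length (f a) ≡ k) →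
                   length (concatMap f xs) ≡ length xs * k
length-concatMap [] _ = refl
length-concatMap {f = f} (x ∷ xs) |f|≡k =
  trans (length-++ (f x)) (cong₂ _+_ (|f|≡k (here refl)) (length-concatMap xs (|f|≡k ∘ there)))

concatMap≡cartesianProductWith : (f : A → B → C) (xs : List A) (ys : List B) →
                                 concatMap (λ x → map (f x) ys) xs ≡ cartesianProductWith f xs ys
concatMap≡cartesianProductWith f [] ys = refl
concatMap≡cartesianProductWith f (x ∷ xs) ys =
  cong (map (f x) ys ++_) (concatMap≡cartesianProductWith f xs ys)

cartesianProductWith≡map : (f : A → B → C) (xs : List A) (ys : List B) →
                           cartesianProductWith f xs ys ≡ map (uncurry f) (cartesianProduct xs ys)
cartesianProductWith≡map f [] ys = refl
cartesianProductWith≡map f (x ∷ xs) ys = begin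
  map (f x) ys ++ cartesianProductWith f xs ys
    ≡⟨ cong₂ _++_ (map-∘ ys) (cartesianProductWith≡map f xs ys) ⟩
  map (uncurry f) (map (x ,_) ys) ++ map (uncurry f) (cartesianProduct xs ys)
    ≡⟨ map-++ (uncurry f) (map (x ,_) ys) _ ⟨
  map (uncurry f) (cartesianProduct (x ∷ xs) ys) ∎
  where open ≡-Reasoning

length-concat : (xss : List (List A)) → length (concat xss) ≡ sum (map length xss)
length-concat [] = refl
length-concat (xs ∷ xss) = trans (length-++ xs) (cong (length xs +_) (length-concat xss))

map-++-∷-cong : (f : A → B) (bs₁ bs₂ : List A) {b b′ : A} → f b ≡ f b′ →
                map f (bs₁ ++ b ∷ bs₂) ≡ map f (bs₁ ++ b′ ∷ bs₂)
map-++-∷-cong f [] bs₂ e = cong (_∷ map f bs₂) e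
map-++-∷-cong f (a ∷ bs₁) bs₂ e = cong (f a ∷_) (map-++-∷-cong f bs₁ bs₂ e)

All-++-∷ : ∀ {P : A → Set} (bs₁ bs₂ : List A) {b b′ : A} →
           All P (bs₁ ++ b ∷ bs₂) → P b′ → All P (bs₁ ++ b′ ∷ bs₂)
All-++-∷ [] bs₂ (_ ∷ pbs₂) pb′ = pb′ ∷ pbs₂
All-++-∷ (a ∷ bs₁) bs₂ (pa ∷ pbs) pb′ = pa ∷ All-++-∷ bs₁ bs₂ pbs pb′

concat-++-∷ : ∀ (bs₁ bs₂ : List (List A)) u v →
              concat (bs₁ ++ (u ++ v) ∷ bs₂) ≡ (concat bs₁ ++ u) ++ v ++ concat bs₂
concat-++-∷ bs₁ bs₂ u v = begin
  concat (bs₁ ++ (u ++ v) ∷ bs₂)           ≡⟨ concat-++ bs₁ _ ⟨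
  concat bs₁ ++ (u ++ v) ++ concat bs₂     ≡⟨ cong (concat bs₁ ++_) (++-assoc u v (concat bs₂)) ⟩
  concat bs₁ ++ u ++ v ++ concat bs₂       ≡⟨ ++-assoc (concat bs₁) u _ ⟨
  (concat bs₁ ++ u) ++ v ++ concat bs₂     ∎
  where open ≡-Reasoning

-- Reading the Boolean definitions as propositions

memb⇔∈ : ∀ {x} xs → T (memb x xs) ⇔ x ∈ xs
memb⇔∈ {x} xs = mk⇔ (Any.map (≡ᵇ⇒≡ x _) ∘ any⁻ _ xs) (any⁺ _ ∘ Any.map (≡⇒≡ᵇ x _))

all-memb⇔⊆ : ∀ xs ys → T (all (λ x → memb x ys) xs) ⇔ xs ⊆ ys
all-memb⇔⊆ xs ys = mk⇔ sound complete
  where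
  sound : T (all (λ x → memb x ys) xs) → xs ⊆ ys
  sound t = to (memb⇔∈ ys) ∘ All.lookup (all⁺ _ xs t)

  complete : xs ⊆ ys → T (all (λ x → memb x ys) xs)
  complete xs⊆ys = all⁻ (λ x → memb x ys) (All.tabulate (λ {z} z∈ → from (memb⇔∈ {z} ys) (xs⊆ys z∈)))

T-not⇔¬T : ∀ {b} → T (not b) ⇔ (¬ T b)
T-not⇔¬T {false} = mk⇔ (const (λ ())) (const tt)
T-not⇔¬T {true}  = mk⇔ (λ ()) (λ ¬t → ¬t tt)

distinct⇔Unique : ∀ xs → T (distinct xs) ⇔ Unique xs
distinct⇔Unique [] = mk⇔ (const []) (const tt)
distinct⇔Unique (x ∷ xs) = mk⇔ sound complete
  where
  sound : T (distinct (x ∷ xs)) → Unique (x ∷ xs)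
  sound t = let x∉ , xs! = to (T-∧ {not (memb x xs)}) t
            in ¬Any⇒All¬ xs (to T-not⇔¬T x∉ ∘ from (memb⇔∈ xs)) ∷ to (distinct⇔Unique xs) xs!

  complete : Unique (x ∷ xs) → T (distinct (x ∷ xs))
  complete (x≢xs ∷ xs!) =
    from T-∧ (from T-not⇔¬T (All¬⇒¬Any x≢xs ∘ to (memb⇔∈ xs)) , from (distinct⇔Unique xs) xs!)

∈-range⁻ : ∀ {z} → z ∈ range n → 0 < z × z ≤ n
∈-range⁻ z∈ with _ , i∈ , refl ← ∈-map⁻ suc z∈ = s≤s z≤n , ∈-upTo⁻ i∈

∈-range⁺ : ∀ {z} → 0 < z → z ≤ n → z ∈ range n
∈-range⁺ {z = suc _} _ z<n = ∈-map⁺ suc (∈-upTo⁺ z<n)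

range-Unique : ∀ n → Unique (range n)
range-Unique n = map⁺ suc-injective (upTo⁺ n)

record Arrangement (n : ℕ) (w : List ℕ) : Set where
  field
    length≡ : length w ≡ n
    unique  : Unique w
    ⊆range  : w ⊆ range n
    range⊆  : range n ⊆ w

Arrangement-bound : ∀ {w} → Arrangement n w → ∀ {z} → z ∈ w → z < suc n
Arrangement-bound a = s≤s ∘ proj₂ ∘ ∈-range⁻ ∘ Arrangement.⊆range a

Arrangement⇒suc∉ : ∀ {w} → Arrangement n w → suc n ∉ w
Arrangement⇒suc∉ a = 1+n≰n ∘ Arrangement-bound a

record LinPartition (n m : ℕ) (π : List (List ℕ)) : Set where
  field
    #blocks        : length π ≡ m
    nonemptyBlocks : All (T ∘ nonempty) π
    increasing     : T (increasingMins π)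
    arrangement    : Arrangement n (concat π)

isLinPartition⇔ : ∀ {π} → T (isLinPartition n m π) ⇔ LinPartition n m π
isLinPartition⇔ {n} {m} {π} = mk⇔ sound complete
  where
  w = concat π

  sound : T (isLinPartition n m π) → LinPartition n m π
  sound t =
    let #π , t = to (T-∧ {length π ≡ᵇ m}) t
        ne , t = to (T-∧ {all nonempty π}) t
        inc , t = to (T-∧ {increasingMins π}) t
        #w , t = to (T-∧ {length w ≡ᵇ n}) t
        w! , t = to (T-∧ {distinct w}) t
        w⊆ , ⊆w = to (T-∧ {all (λ x → memb x (range n)) w}) t
    in record
      { #blocks = ≡ᵇ⇒≡ _ _ #π
      ; nonemptyBlocks = all⁺ nonempty π ne
      ; increasing = inc
      ; arrangement = record
        { length≡ = ≡ᵇ⇒≡ _ _ #w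
        ; unique = to (distinct⇔Unique w) w!
        ; ⊆range = to (all-memb⇔⊆ w (range n)) w⊆
        ; range⊆ = to (all-memb⇔⊆ (range n) w) ⊆w
        }
      }

  complete : LinPartition n m π → T (isLinPartition n m π)
  complete lp =
    from T-∧ (≡⇒≡ᵇ _ _ #blocks ,
    from T-∧ (all⁻ nonempty nonemptyBlocks ,
    from T-∧ (increasing ,
    from T-∧ (≡⇒≡ᵇ _ _ length≡ ,
    from T-∧ (from (distinct⇔Unique w) unique ,
    from T-∧ (from (all-memb⇔⊆ w (range n)) ⊆range , from (all-memb⇔⊆ (range n) w) range⊆))))))
    where
    open LinPartition lp
    open Arrangement arrangement

-- The candidates list every partition exactly once

words-suc : ∀ k (as : List ℕ) → words (suc k) as ≡ cartesianProductWith _∷_ as (words k as)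
words-suc k as = concatMap≡cartesianProductWith _∷_ as (words k as)

∈-words⁺ : ∀ {as} w → All (_∈ as) w → w ∈ words (length w) as
∈-words⁺ [] [] = here refl
∈-words⁺ {as} (x ∷ w) (x∈as ∷ w⊆as) =
  subst (x ∷ w ∈_) (sym (words-suc (length w) as)) (∈-cartesianProductWith⁺ _∷_ x∈as (∈-words⁺ w w⊆as))

length-∈-words : ∀ k as {w} → w ∈ words k as → length w ≡ k
length-∈-words zero as (here refl) = refl
length-∈-words (suc k) as w∈
  with _ , _ , _ , w′∈ , refl ←
         ∈-cartesianProductWith⁻ _∷_ as (words k as) (subst (_ ∈_) (words-suc k as) w∈)
  = cong suc (length-∈-words k as w′∈)

words-Unique : ∀ k {as} → Unique as → Unique (words k as)
words-Unique zero _ = [] ∷ []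
words-Unique (suc k) {as} as! =
  subst Unique (sym (words-suc k as)) (cartesianProductWith⁺ _∷_ ∷-injective as! (words-Unique k as!))

∈-compositions⁺ : ∀ c → All (0 <_) c → c ∈ compositions (sum c) (length c)
∈-compositions⁺ [] [] = here refl
∈-compositions⁺ (suc p ∷ c) (_ ∷ c>0) =
  ∈-concatMap⁺ (λ q → map (suc q ∷_) (compositions (suc (p + sum c) ∸ suc q) (length c)))
    (lose (∈-upTo⁺ (s≤s (m≤m+n p (sum c))))
      (∈-map⁺ (suc p ∷_) (subst (λ t → c ∈ compositions t (length c)) (sym (m+n∸m≡n p (sum c)))
        (∈-compositions⁺ c c>0))))

sum-∈-compositions : ∀ t m {c} → c ∈ compositions t m → sum c ≡ t
sum-∈-compositions zero zero (here refl) = refl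
sum-∈-compositions (suc t) (suc m) c∈
  with p , p∈ , c∈′ ← find (∈-concatMap⁻ _ {upTo (suc t)} c∈)
  with c′ , c′∈ , refl ← ∈-map⁻ (suc p ∷_) c∈′
  = trans (cong (suc p +_) (sum-∈-compositions (suc t ∸ suc p) m c′∈)) (m+[n∸m]≡n (∈-upTo⁻ p∈))

compositions-Unique : ∀ t m → Unique (compositions t m)
compositions-Unique zero zero = [] ∷ []
compositions-Unique (suc t) zero = []
compositions-Unique zero (suc m) = []
compositions-Unique (suc t) (suc m) =
  concatMap-Unique (upTo⁺ (suc t))
    (λ {p} _ → map⁺ ∷-injectiveʳ (compositions-Unique (suc t ∸ suc p) m))
    heads-differ
  where
  heads-differ : ∀ {p q} → p ∈ upTo (suc t) → q ∈ upTo (suc t) → p ≢ q →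
                 Disjoint (map (suc p ∷_) (compositions (suc t ∸ suc p) m))
                          (map (suc q ∷_) (compositions (suc t ∸ suc q) m))
  heads-differ {p} {q} _ _ p≢q (c∈p , c∈q)
    with _ , _ , refl ← ∈-map⁻ (suc p ∷_) c∈p
    with _ , _ , e ← ∈-map⁻ (suc q ∷_) c∈q
    = p≢q (suc-injective (∷-injectiveˡ e))

splitAt-++ : (u v : List ℕ) → splitAt (length u) (u ++ v) ≡ (u , v)
splitAt-++ [] v = refl
splitAt-++ (x ∷ u) v = cong (Product.map₁ (x ∷_)) (splitAt-++ u v)

splitBy-inverse : ∀ c (w : List ℕ) → sum c ≡ length w →
                  concat (splitBy c w) ≡ w × map length (splitBy c w) ≡ c
splitBy-inverse [] [] _ = refl , refl
splitBy-inverse (k ∷ ks) w |c|≡|w| rewrite splitAt-defn k w =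
  trans (cong (take k w ++_) concat≡) (take++drop≡id k w) ,
  cong₂ _∷_ (trans (length-take k w) (m≤n⇒m⊓n≡m k≤|w|)) lengths≡
  where
  k≤|w| : k ≤ length w
  k≤|w| = subst (k ≤_) |c|≡|w| (m≤m+n k (sum ks))

  |ks|≡|rest| : sum ks ≡ length (drop k w)
  |ks|≡|rest| = begin
    sum ks              ≡⟨ m+n∸m≡n k (sum ks) ⟨
    k + sum ks ∸ k      ≡⟨ cong (_∸ k) |c|≡|w| ⟩
    length w ∸ k        ≡⟨ length-drop k w ⟨
    length (drop k w)   ∎
    where open ≡-Reasoning

  concat≡ : concat (splitBy ks (drop k w)) ≡ drop k w
  concat≡ = proj₁ (splitBy-inverse ks (drop k w) |ks|≡|rest|)
  lengths≡ : map length (splitBy ks (drop k w)) ≡ ks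
  lengths≡ = proj₂ (splitBy-inverse ks (drop k w) |ks|≡|rest|)

splitBy-blocks : (π : List (List ℕ)) → splitBy (map length π) (concat π) ≡ π
splitBy-blocks [] = refl
splitBy-blocks (b ∷ π) rewrite splitAt-++ b (concat π) = cong (b ∷_) (splitBy-blocks π)

wordAndShape : List (List ℕ) → List ℕ × List ℕ
wordAndShape π = concat π , map length π

cutting : List ℕ × List ℕ → List (List ℕ)
cutting (w , c) = splitBy c w

candidates≡ : ∀ n m →
              candidates n m ≡ map cutting (cartesianProduct (words n (range n)) (compositions n m))
candidates≡ n m =
  trans (concatMap≡cartesianProductWith (λ w c → splitBy c w) (words n (range n)) (compositions n m))
        (cartesianProductWith≡map (λ w c → splitBy c w) (words n (range n)) (compositions n m))

∈-candidates⁺ : ∀ {π} → LinPartition n m π → π ∈ candidates n m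
∈-candidates⁺ {n} {m} {π} lp =
  subst (π ∈_) (sym (candidates≡ n m))
    (subst (_∈ _) (splitBy-blocks π) (∈-map⁺ cutting (∈-cartesianProduct⁺ word∈ shape∈)))
  where
  open LinPartition lp
  open Arrangement arrangement

  word∈ : concat π ∈ words n (range n)
  word∈ = subst (λ k → concat π ∈ words k (range n)) length≡ (∈-words⁺ (concat π) (All.tabulate ⊆range))

  nonempty⇒positive : ∀ {b} → T (nonempty b) → 0 < length b
  nonempty⇒positive {_ ∷ _} _ = s≤s z≤n

  shape∈ : map length π ∈ compositions n m
  shape∈ = subst₂ (λ t k → map length π ∈ compositions t k)
             (trans (sym (length-concat π)) length≡) (trans (length-map length π) #blocks)
             (∈-compositions⁺ (map length π) (AllP.map⁺ (All.map nonempty⇒positive nonemptyBlocks)))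

-- wordAndShape undoes cutting on pairs of matching size, so cutting is injective there.
candidates-Unique : ∀ n m → Unique (candidates n m)
candidates-Unique n m =
  subst Unique (sym (candidates≡ n m)) (map⁻ (subst Unique (sym shapes≡) (cartesianProduct⁺ Ws! Cs!)))
  where
  Ws = words n (range n)
  Cs = compositions n m
  Ws! = words-Unique n (range-Unique n)
  Cs! = compositions-Unique n m

  inverse : ∀ {p} → p ∈ cartesianProduct Ws Cs → wordAndShape (cutting p) ≡ p
  inverse {w , c} p∈ =
    let w∈ , c∈ = ∈-cartesianProduct⁻ Ws Cs p∈
        concat≡ , lengths≡ =
          splitBy-inverse c w (trans (sum-∈-compositions n m c∈) (sym (length-∈-words n _ w∈)))
    in cong₂ _,_ concat≡ lengths≡

  shapes≡ : map wordAndShape (map cutting (cartesianProduct Ws Cs)) ≡ cartesianProduct Ws Cs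
  shapes≡ = trans (sym (map-∘ (cartesianProduct Ws Cs))) (map-id-local (All.tabulate inverse))

lahPartitions : ℕ → ℕ → ℕ → List (List (List ℕ))
lahPartitions ℓ n m = filter (λ π → T? (isLinPartition n m π ∧ (weight π ≡ᵇ ℓ))) (candidates n m)

∈-lahPartitions⇔ : ∀ {ℓ π} → π ∈ lahPartitions ℓ n m ⇔ (LinPartition n m π × weight π ≡ ℓ)
∈-lahPartitions⇔ {n} {m} {ℓ} {π} = mk⇔ sound complete
  where
  P? = λ π → T? (isLinPartition n m π ∧ (weight π ≡ᵇ ℓ))

  sound : π ∈ lahPartitions ℓ n m → LinPartition n m π × weight π ≡ ℓ
  sound π∈ = let lp , w = to (T-∧ {isLinPartition n m π}) (proj₂ (∈-filter⁻ P? {xs = candidates n m} π∈))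
             in to isLinPartition⇔ lp , ≡ᵇ⇒≡ _ _ w

  complete : LinPartition n m π × weight π ≡ ℓ → π ∈ lahPartitions ℓ n m
  complete (lp , w) = ∈-filter⁺ P? (∈-candidates⁺ lp) (from T-∧ (from isLinPartition⇔ lp , ≡⇒≡ᵇ _ _ w))

lahPartitions-Unique : ∀ ℓ n m → Unique (lahPartitions ℓ n m)
lahPartitions-Unique ℓ n m = filter⁺ _ (candidates-Unique n m)

-- Adding a new largest element

Arrangement-insertMax : ∀ u v → Arrangement n (u ++ v) → Arrangement (suc n) (u ++ suc n ∷ v)
Arrangement-insertMax {n} u v a = record
  { length≡ = trans (↭-length shifted) (cong suc length≡)
  ; unique = PermutationSetoid.Unique-resp-↭ (setoid ℕ) (↭⇒↭ₛ (↭-sym shifted))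
               (¬Any⇒All¬ (u ++ v) (Arrangement⇒suc∉ a) ∷ unique)
  ; ⊆range = λ z∈ → ⊆range′ (∈-resp-↭ shifted z∈)
  ; range⊆ = range⊆′
  }
  where
  open Arrangement a
  shifted : u ++ suc n ∷ v ↭ suc n ∷ u ++ v
  shifted = shift (suc n) u v

  ⊆range′ : suc n ∷ u ++ v ⊆ range (suc n)
  ⊆range′ (here refl) = ∈-range⁺ (s≤s z≤n) ≤-refl
  ⊆range′ (there z∈) = let 0<z , z≤ = ∈-range⁻ (⊆range z∈) in ∈-range⁺ 0<z (m≤n⇒m≤1+n z≤)

  range⊆′ : range (suc n) ⊆ u ++ suc n ∷ v
  range⊆′ z∈ with ∈-range⁻ z∈
  ... | 0<z , z≤1+n with m≤n⇒m<n∨m≡n z≤1+n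
  ...   | inj₁ (s≤s z≤) = ∈-resp-↭ (↭-sym shifted) (there (range⊆ (∈-range⁺ 0<z z≤)))
  ...   | inj₂ refl = ∈-insert u

minimum-∷ : ∀ y a l → minimum (y ∷ a ∷ l) ≡ a ⊓ minimum (y ∷ l)
minimum-∷ y a l with a <ᵇ minimum (y ∷ l) in lt
... | true = sym (m≤n⇒m⊓n≡m (<⇒≤ (<ᵇ⇒< a _ (subst T (sym lt) tt))))
... | false = sym (m≥n⇒m⊓n≡n (≮⇒≥ (λ a< → subst T lt (<⇒<ᵇ a<))))

minimum≤head : ∀ y l → minimum (y ∷ l) ≤ y
minimum≤head y [] = ≤-refl
minimum≤head y (a ∷ l) = subst (_≤ y) (sym (minimum-∷ y a l)) (≤-trans (m⊓n≤n a _) (minimum≤head y l))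

minimum-insertMax : ∀ {x} y ys₁ ys₂ → y < x → minimum (y ∷ ys₁ ++ x ∷ ys₂) ≡ minimum (y ∷ ys₁ ++ ys₂)
minimum-insertMax {x} y [] ys₂ y<x =
  trans (minimum-∷ y x ys₂) (m≥n⇒m⊓n≡n (≤-trans (minimum≤head y ys₂) (<⇒≤ y<x)))
minimum-insertMax {x} y (a ∷ ys₁) ys₂ y<x = begin
  minimum (y ∷ a ∷ ys₁ ++ x ∷ ys₂) ≡⟨ minimum-∷ y a (ys₁ ++ x ∷ ys₂) ⟩
  a ⊓ minimum (y ∷ ys₁ ++ x ∷ ys₂) ≡⟨ cong (a ⊓_) (minimum-insertMax y ys₁ ys₂ y<x) ⟩
  a ⊓ minimum (y ∷ ys₁ ++ ys₂)     ≡⟨ minimum-∷ y a (ys₁ ++ ys₂) ⟨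
  minimum (y ∷ a ∷ ys₁ ++ ys₂)     ∎
  where open ≡-Reasoning

blockWeight-insertMax : ∀ {x} y ys₁ ys₂ → y < x →
                        blockWeight (y ∷ ys₁ ++ x ∷ ys₂) ≡ blockWeight (y ∷ ys₁ ++ ys₂)
blockWeight-insertMax {x} y ys₁ ys₂ y<x = cong length (begin
  filter P? (ys₁ ++ x ∷ ys₂)
    ≡⟨ filter-++ P? ys₁ (x ∷ ys₂) ⟩
  filter P? ys₁ ++ filter P? (x ∷ ys₂)
    ≡⟨ cong (filter P? ys₁ ++_) (filter-reject P? (<-asym y<x ∘ <ᵇ⇒< x y)) ⟩
  filter P? ys₁ ++ filter P? ys₂
    ≡⟨ filter-++ P? ys₁ ys₂ ⟨
  filter P? (ys₁ ++ ys₂) ∎)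
  where
  open ≡-Reasoning
  P? = λ z → T? (z <ᵇ y)

increasingMins-cong : ∀ π π′ → map minimum π ≡ map minimum π′ → increasingMins π ≡ increasingMins π′
increasingMins-cong [] [] _ = refl
increasingMins-cong (_ ∷ []) (_ ∷ []) _ = refl
increasingMins-cong (b ∷ c ∷ π) (b′ ∷ c′ ∷ π′) eq =
  cong₂ _∧_ (cong₂ _<ᵇ_ (∷-injectiveˡ eq) (∷-injectiveˡ (∷-injectiveʳ eq)))
            (increasingMins-cong (c ∷ π) (c′ ∷ π′) (∷-injectiveʳ eq))

insertions : ℕ → List ℕ → List (List ℕ)
insertions x [] = []
insertions x (y ∷ ys) = (y ∷ x ∷ ys) ∷ map (y ∷_) (insertions x ys)

partitionInsertions : ℕ → List (List ℕ) → List (List (List ℕ))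
partitionInsertions x [] = []
partitionInsertions x (b ∷ π) = map (_∷ π) (insertions x b) ++ map (b ∷_) (partitionInsertions x π)

data Inserted (x : ℕ) : List ℕ → List ℕ → Set where
  inserted : ∀ y ys₁ ys₂ → Inserted x (y ∷ ys₁ ++ ys₂) (y ∷ ys₁ ++ x ∷ ys₂)

data InsertedInBlock (x : ℕ) : List (List ℕ) → List (List ℕ) → Set where
  insertedIn : ∀ bs₁ bs₂ {b b′} → Inserted x b b′ → InsertedInBlock x (bs₁ ++ b ∷ bs₂) (bs₁ ++ b′ ∷ bs₂)

∈-insertions⁻ : ∀ {x} b {b′} → b′ ∈ insertions x b → Inserted x b b′
∈-insertions⁻ (y ∷ ys) (here refl) = inserted y [] ys
∈-insertions⁻ (y ∷ ys) (there b′∈)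
  with _ , b″∈ , refl ← ∈-map⁻ (y ∷_) b′∈
  with inserted y′ ys₁ ys₂ ← ∈-insertions⁻ ys b″∈
  = inserted y (y′ ∷ ys₁) ys₂

∈-partitionInsertions⁻ : ∀ {x} π {π′} → π′ ∈ partitionInsertions x π → InsertedInBlock x π π′
∈-partitionInsertions⁻ {x} (b ∷ π) π′∈ with ∈-++⁻ (map (_∷ π) (insertions x b)) π′∈
... | inj₁ π′∈₁ with _ , b′∈ , refl ← ∈-map⁻ (_∷ π) π′∈₁ = insertedIn [] π (∈-insertions⁻ b b′∈)
... | inj₂ π′∈₂ with _ , π″∈ , refl ← ∈-map⁻ (b ∷_) π′∈₂
  with insertedIn bs₁ bs₂ ins ← ∈-partitionInsertions⁻ π π″∈ = insertedIn (b ∷ bs₁) bs₂ ins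

Inserted⇒∈ : ∀ {x b b′} → Inserted x b b′ → x ∈ b′
Inserted⇒∈ (inserted y ys₁ ys₂) = there (∈-insert ys₁)

length-insertions : ∀ x b → length (insertions x b) ≡ length b
length-insertions x [] = refl
length-insertions x (y ∷ ys) =
  cong suc (trans (length-map (y ∷_) (insertions x ys)) (length-insertions x ys))

length-partitionInsertions : ∀ x π → length (partitionInsertions x π) ≡ length (concat π)
length-partitionInsertions x [] = refl
length-partitionInsertions x (b ∷ π) = begin
  length (map (_∷ π) (insertions x b) ++ map (b ∷_) (partitionInsertions x π))
    ≡⟨ length-++ (map (_∷ π) (insertions x b)) ⟩
  length (map (_∷ π) (insertions x b)) + length (map (b ∷_) (partitionInsertions x π))
    ≡⟨ cong₂ _+_ (trans (length-map _ (insertions x b)) (length-insertions x b))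
                 (trans (length-map _ (partitionInsertions x π)) (length-partitionInsertions x π)) ⟩
  length b + length (concat π)
    ≡⟨ length-++ b ⟨
  length (b ++ concat π) ∎
  where open ≡-Reasoning

insertions-Unique : ∀ {x} b → x ∉ b → Unique (insertions x b)
insertions-Unique [] _ = []
insertions-Unique {x} (y ∷ ys) x∉ =
  All.tabulate first≢rest ∷ map⁺ ∷-injectiveʳ (insertions-Unique ys (x∉ ∘ there))
  where
  first≢rest : ∀ {b′} → b′ ∈ map (y ∷_) (insertions x ys) → y ∷ x ∷ ys ≢ b′
  first≢rest b′∈ with _ , b″∈ , refl ← ∈-map⁻ (y ∷_) b′∈ with ∈-insertions⁻ ys b″∈
  ... | inserted _ _ _ = λ e → x∉ (there (here (∷-injectiveˡ (∷-injectiveʳ e))))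

partitionInsertions-Unique : ∀ {x} π → x ∉ concat π → Unique (partitionInsertions x π)
partitionInsertions-Unique [] _ = []
partitionInsertions-Unique {x} (b ∷ π) x∉ =
  ++⁺ (map⁺ ∷-injectiveˡ (insertions-Unique b (x∉ ∘ ∈-++⁺ˡ)))
      (map⁺ ∷-injectiveʳ (partitionInsertions-Unique π (x∉ ∘ ∈-++⁺ʳ b)))
      x-only-in-first
  where
  x-only-in-first : Disjoint (map (_∷ π) (insertions x b)) (map (b ∷_) (partitionInsertions x π))
  x-only-in-first (π′∈₁ , π′∈₂)
    with b′ , b′∈ , refl ← ∈-map⁻ (_∷ π) π′∈₁
    with _ , _ , e ← ∈-map⁻ (b ∷_) π′∈₂
    = x∉ (∈-++⁺ˡ (subst (x ∈_) (∷-injectiveˡ e) (Inserted⇒∈ (∈-insertions⁻ b b′∈))))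

deleteAll : ℕ → List ℕ → List ℕ
deleteAll x = filter (λ z → ¬? (z ≟ x))

deleteAll-Inserted : ∀ {x b b′} → Inserted x b b′ → deleteAll x b′ ≡ deleteAll x b
deleteAll-Inserted {x} (inserted y ys₁ ys₂) = begin
  deleteAll x (y ∷ ys₁ ++ x ∷ ys₂)
    ≡⟨ filter-++ P? (y ∷ ys₁) (x ∷ ys₂) ⟩
  deleteAll x (y ∷ ys₁) ++ deleteAll x (x ∷ ys₂)
    ≡⟨ cong (deleteAll x (y ∷ ys₁) ++_) (filter-reject P? (λ x≢x → x≢x refl)) ⟩
  deleteAll x (y ∷ ys₁) ++ deleteAll x ys₂
    ≡⟨ filter-++ P? (y ∷ ys₁) ys₂ ⟨
  deleteAll x (y ∷ ys₁ ++ ys₂) ∎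
  where
  open ≡-Reasoning
  P? = λ z → ¬? (z ≟ x)

deleteAll-InsertedInBlock : ∀ {x π π′} → InsertedInBlock x π π′ → x ∉ concat π →
                            map (deleteAll x) π′ ≡ π
deleteAll-InsertedInBlock {x} {π} (insertedIn bs₁ bs₂ ins) x∉ =
  trans (map-++-∷-cong (deleteAll x) bs₁ bs₂ (deleteAll-Inserted ins))
        (map-id-local (All.tabulate (λ b∈ → filter-all P? (All.tabulate (x∉block b∈)))))
  where
  P? = λ z → ¬? (z ≟ x)

  x∉block : ∀ {b z} → b ∈ π → z ∈ b → z ≢ x
  x∉block b∈ z∈ refl = x∉ (∈-concat⁺′ z∈ b∈)

LinPartition⇒suc∉ : ∀ {π} → LinPartition n m π → suc n ∉ concat π
LinPartition⇒suc∉ = Arrangement⇒suc∉ ∘ LinPartition.arrangement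

deleteAll-partitionInsertions : ∀ {π ρ} → LinPartition n m π → ρ ∈ partitionInsertions (suc n) π →
                                map (deleteAll (suc n)) ρ ≡ π
deleteAll-partitionInsertions {π = π} lp ρ∈ =
  deleteAll-InsertedInBlock (∈-partitionInsertions⁻ π ρ∈) (LinPartition⇒suc∉ lp)

LinPartition-insertMax : ∀ {π π′} → LinPartition n m π → InsertedInBlock (suc n) π π′ →
                         LinPartition (suc n) m π′ × weight π′ ≡ weight π
LinPartition-insertMax {n} lp (insertedIn bs₁ bs₂ (inserted y ys₁ ys₂)) =
  record
    { #blocks = trans (length-++ bs₁) (trans (sym (length-++ bs₁)) #blocks)
    ; nonemptyBlocks = All-++-∷ bs₁ bs₂ nonemptyBlocks tt
    ; increasing =
        subst T (increasingMins-cong _ _ (map-++-∷-cong minimum bs₁ bs₂ (sym minimum≡))) increasing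
    ; arrangement =
        subst (Arrangement (suc n)) (sym (concat-++-∷ bs₁ bs₂ (y ∷ ys₁) (suc n ∷ ys₂)))
          (Arrangement-insertMax (concat bs₁ ++ y ∷ ys₁) (ys₂ ++ concat bs₂)
            (subst (Arrangement n) (concat-++-∷ bs₁ bs₂ (y ∷ ys₁) ys₂) arrangement))
    }
  , cong sum (map-++-∷-cong blockWeight bs₁ bs₂ (blockWeight-insertMax y ys₁ ys₂ y<x))
  where
  open LinPartition lp

  y<x : y < suc n
  y<x = Arrangement-bound arrangement (∈-concat⁺′ (here refl) (∈-++⁺ʳ bs₁ (here refl)))

  minimum≡ : minimum (y ∷ ys₁ ++ suc n ∷ ys₂) ≡ minimum (y ∷ ys₁ ++ ys₂)
  minimum≡ = minimum-insertMax y ys₁ ys₂ y<x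

increasingMins-snoc : ∀ {x} π → T (increasingMins π) → All (λ b → minimum b < x) π →
                      T (increasingMins (π ++ [ [ x ] ]))
increasingMins-snoc [] _ _ = tt
increasingMins-snoc (b ∷ []) _ (b<x ∷ []) = from T-∧ (<⇒<ᵇ b<x , tt)
increasingMins-snoc (b ∷ c ∷ π) inc (_ ∷ mins<x) =
  let b<c , inc′ = to (T-∧ {minimum b <ᵇ minimum c}) inc
  in from T-∧ (b<c , increasingMins-snoc (c ∷ π) inc′ mins<x)

LinPartition-appendSingleton : ∀ {π} → LinPartition n m π →
  LinPartition (suc n) (suc m) (π ++ [ [ suc n ] ]) × weight (π ++ [ [ suc n ] ]) ≡ weight π
LinPartition-appendSingleton {n} {m} {π} lp =
  record
    { #blocks = trans (length-++ π) (trans (cong (_+ 1) #blocks) (+-comm m 1))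
    ; nonemptyBlocks = AllP.++⁺ nonemptyBlocks (tt ∷ [])
    ; increasing = increasingMins-snoc π increasing (All.tabulate minimum<x)
    ; arrangement =
        subst (Arrangement (suc n)) (concat-++ π [ [ suc n ] ])
          (Arrangement-insertMax (concat π) []
            (subst (Arrangement n) (sym (++-identityʳ (concat π))) arrangement))
    }
  , trans (cong sum (map-++ blockWeight π _)) (trans (sum-++ (map blockWeight π) _) (+-identityʳ _))
  where
  open LinPartition lp

  minimum<x : ∀ {b} → b ∈ π → minimum b < suc n
  minimum<x {y ∷ ys} b∈ =
    ≤-trans (s≤s (minimum≤head y ys)) (Arrangement-bound arrangement (∈-concat⁺′ (here refl) b∈))
  minimum<x {[]} b∈ = ⊥-elim (All.lookup nonemptyBlocks b∈)

LinPartition-prependMax : ∀ {b} → LinPartition n 1 [ b ] →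
                          LinPartition (suc n) 1 [ suc n ∷ b ] × weight [ suc n ∷ b ] ≡ n
LinPartition-prependMax {n} {b} lp =
  record
    { #blocks = refl
    ; nonemptyBlocks = tt ∷ []
    ; increasing = tt
    ; arrangement = Arrangement-insertMax [] (b ++ []) arrangement
    }
  , (begin
      length (filter P? b) + 0 ≡⟨ +-identityʳ _ ⟩
      length (filter P? b)     ≡⟨ cong length (filter-all P? (All.tabulate below)) ⟩
      length b                 ≡⟨ cong length (++-identityʳ b) ⟨
      length (b ++ [])         ≡⟨ Arrangement.length≡ arrangement ⟩
      n                        ∎)
  where
  open LinPartition lp
  open ≡-Reasoning
  P? = λ z → T? (z <ᵇ suc n)

  below : ∀ {z} → z ∈ b → T (z <ᵇ suc n)
  below z∈ = <⇒<ᵇ (Arrangement-bound arrangement (∈-++⁺ˡ z∈))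

-- Partitions of every admissible weight

-- suc k goes either first in the block, giving weight suc k, or right after the first element,
-- keeping the weight.
singleBlock-exists : ∀ k ℓ → ℓ ≤ k → ∃ λ b → LinPartition (suc k) 1 [ b ] × weight [ b ] ≡ ℓ
singleBlock-exists zero zero _ = [ 1 ] , to isLinPartition⇔ tt , refl
singleBlock-exists (suc k) ℓ ℓ≤ with m≤n⇒m<n∨m≡n ℓ≤
... | inj₂ refl with b , lp , _ ← singleBlock-exists k 0 z≤n = _ , LinPartition-prependMax lp
... | inj₁ (s≤s ℓ≤k) with singleBlock-exists k ℓ ℓ≤k
...   | [] , lp , _ = ⊥-elim (All.head (LinPartition.nonemptyBlocks lp))
...   | (y ∷ ys) , lp , w =
  let lp′ , w′ = LinPartition-insertMax lp (insertedIn [] [] (inserted y [] ys)) in _ , lp′ , trans w′ w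

linPartition-exists : ∀ j n ℓ → suc j ≤ n → ℓ ≤ n ∸ suc j →
                      ∃ λ π → LinPartition n (suc j) π × weight π ≡ ℓ
linPartition-exists zero (suc k) ℓ _ ℓ≤ with b , lp , w ← singleBlock-exists k ℓ ℓ≤ = [ b ] , lp , w
linPartition-exists (suc j) (suc n) ℓ (s≤s j<n) ℓ≤ with π , lp , w ← linPartition-exists j n ℓ j<n ℓ≤ =
  let lp′ , w′ = LinPartition-appendSingleton lp in _ , lp′ , trans w′ w

-- Counting the extensions

extensions : ℕ → ℕ → ℕ → List (List (List ℕ))
extensions ℓ n m = concatMap (partitionInsertions (suc n)) (lahPartitions ℓ n m)

length-extensions : ∀ ℓ n m → length (extensions ℓ n m) ≡ W ℓ n m * n
length-extensions ℓ n m = length-concatMap (lahPartitions ℓ n m) λ {π} π∈ →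
  let lp , _ = to ∈-lahPartitions⇔ π∈
  in trans (length-partitionInsertions (suc n) π) (Arrangement.length≡ (LinPartition.arrangement lp))

extensions-Unique : ∀ ℓ n m → Unique (extensions ℓ n m)
extensions-Unique ℓ n m =
  concatMap-Unique (lahPartitions-Unique ℓ n m)
    (λ {π} π∈ → partitionInsertions-Unique π (LinPartition⇒suc∉ (linPartition π∈)))
    (λ π∈ π′∈ π≢π′ (ρ∈ , ρ∈′) →
       π≢π′ (trans (sym (deleteAll-partitionInsertions (linPartition π∈) ρ∈))
                   (deleteAll-partitionInsertions (linPartition π′∈) ρ∈′)))
  where
  linPartition : ∀ {π} → π ∈ lahPartitions ℓ n m → LinPartition n m π
  linPartition = proj₁ ∘ to ∈-lahPartitions⇔

extensions-⊆ : ∀ ℓ n m → extensions ℓ n m ⊆ lahPartitions ℓ (suc n) m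
extensions-⊆ ℓ n m ρ∈ with π , π∈ , ρ∈′ ← find (∈-concatMap⁻ _ {lahPartitions ℓ n m} ρ∈) =
  let lp , w = to ∈-lahPartitions⇔ π∈
      lp′ , w′ = LinPartition-insertMax lp (∈-partitionInsertions⁻ π ρ∈′)
  in from ∈-lahPartitions⇔ (lp′ , trans w′ w)

-- Deleting suc n from an extension gives back a partition, which has no empty block; deleting it
-- from π ++ [ [ suc n ] ] leaves one.
singleton-∉-extensions : ∀ ℓ n m π → π ++ [ [ suc n ] ] ∉ extensions ℓ n m
singleton-∉-extensions ℓ n m π ρ∈ with π′ , π′∈ , ρ∈′ ← find (∈-concatMap⁻ _ {lahPartitions ℓ n m} ρ∈) =
  All.lookup (LinPartition.nonemptyBlocks lp) (subst ([] ∈_) (deleteAll-partitionInsertions lp ρ∈′) []∈)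
  where
  lp = proj₁ (to ∈-lahPartitions⇔ π′∈)

  []∈ : [] ∈ map (deleteAll (suc n)) (π ++ [ [ suc n ] ])
  []∈ = subst ([] ∈_) (sym (map-++ (deleteAll (suc n)) π _))
          (∈-++⁺ʳ _ (here (sym (filter-reject (λ z → ¬? (z ≟ suc n)) (λ x≢x → x≢x refl)))))

mainTheorem6 : (n m ℓ : ℕ) → 2 ≤ m → m ≤ n → ℓ ≤ n ∸ m →
                 (n ∸ 1) * W ℓ (n ∸ 1) m < W ℓ n m
mainTheorem6 (suc (suc n)) m@(suc (suc j)) ℓ (s≤s (s≤s z≤n)) (s≤s (s≤s j≤n)) ℓ≤
  with π₀ , lp₀ , w₀ ← linPartition-exists j (suc n) ℓ (s≤s j≤n) ℓ≤ = begin-strict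
    suc n * W ℓ (suc n) m                    ≡⟨ *-comm (suc n) _ ⟩
    W ℓ (suc n) m * suc n                    ≡⟨ length-extensions ℓ (suc n) m ⟨
    length (extensions ℓ (suc n) m)          <⟨ n<1+n _ ⟩
    length (π₁ ∷ extensions ℓ (suc n) m)     ≤⟨ Unique-⊆⇒length≤ (≡-dec (≡-dec _≟_)) π₁∷ext! π₁∷ext⊆ ⟩
    W ℓ (suc (suc n)) m                      ∎
  where
  open ≤-Reasoning
  π₁ = π₀ ++ [ [ suc (suc n) ] ]

  π₁∷ext! : Unique (π₁ ∷ extensions ℓ (suc n) m)
  π₁∷ext! = All.tabulate (λ ρ∈ π₁≡ρ → singleton-∉-extensions ℓ (suc n) m π₀ (subst (_∈ _) (sym π₁≡ρ) ρ∈))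
          ∷ extensions-Unique ℓ (suc n) m

  π₁∷ext⊆ : π₁ ∷ extensions ℓ (suc n) m ⊆ lahPartitions ℓ (suc (suc n)) m
  π₁∷ext⊆ (here refl) =
    let lp , w = LinPartition-appendSingleton lp₀ in from ∈-lahPartitions⇔ (lp , trans w w₀)
  π₁∷ext⊆ (there ρ∈) = extensions-⊆ ℓ (suc n) m ρ∈
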